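{- Let $(C,\cdot)$ be an HFP-code of length $4n$ and let $D_1\subseteq C$ be the set of codewords with a $0$ in the first coordinate. Then the triple $(C,D_1,\mathbf 1)$ is a left Hadamard group (with respect to the group $(C,\cdot)$).
   Context: Let $\mathbb{F}=\mathbb{Z}_2$. $\mathbf 0,\mathbf 1$ denote the all-zero and all-one vectors; for a permutation $\pi$ of $\{1,\dots,m\}$ and $v\in\mathbb{F}^m$, $\pi(v)=(v_{\pi^{ -1}(1)},\dots,v_{\pi^{ -1}(m)})$. A binary Hadamard matrix of order $4n$ is obtained from a $4n\times4n$ matrix with entries $\pm1$ and $HH^T=4nI$ by replacing $+1$ by $0$ and $-1$ by $1$; the binary Hadamard code it defines is the set of its rows together with their complements ($8n$ codewords). A code $C\subseteq\mathbb{F}^m$ with $\mathbf 0\in C$ is propelinear if to each $x\in C$ a coordinate permutation $\pi_x$ is assigned such that for all $x,y\in C$: $x+\pi_x(y)\in C$ and $\pi_x\pi_y=\pi_{x+\pi_x(y)}$; then $x\cdot y:=x+\pi_x(y)$ makes $(C,\cdot)$ a group with identity $\mathbf 0$. An HFP-code of length $4n$ is a propelinear code that is also a binary Hadamard code of length $4n$, with $\pi_{\mathbf 0}=\pi_{\mathbf 1}=\mathrm{id}$ and such that for every $a\in C\setminus\{\mathbf 0,\mathbf 1\}$, $\pi_a$ has no fixed coordinate. A left Hadamard group of order $8n$ is a triple $(G,D,u)$ where $G$ is a group of order $8n$, $D\subseteq G$ has $4n$ elements, and $u$ is a central involution of $G$, such that (i) $|aD\cap D|=2n$ for every $a\in G\setminus\langle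 u\rangle$, and (ii) $|aD\cap\{b,bu\}|=1$ for all $a,b\in G$. -}

module Defs where

open import Data.Bool using (Bool; true; false; _xor_; if_then_else_)
import Data.Bool.Properties as BoolP
open import Data.Nat using (ℕ; zero; suc; _*_)
open import Data.Integer as ℤ using (ℤ; +_; -[1+_])
open import Data.Fin using (Fin; zero; suc)
import Data.Fin.Properties as FinP
open import Data.Fin.Permutation using (Permutation′; _⟨$⟩ʳ_; _⟨$⟩ˡ_)
open import Data.Vec using (Vec; tabulate; lookup; zipWith; replicate; head)
import Data.Vec.Properties as VecP
open import Data.List using (List; foldr; map; filter; length; allFin)
open import Data.List.Relation.Unary.Any using (Any)
open import Data.List.Relation.Unary.All using (All)
open import Data.List.Relation.Unary.Unique.Propositional using (Unique)
open import Data.List.Membership.Propositional using (_∈_)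
import Data.List.Membership.DecPropositional as DecMem
open import Data.Product using (Σ; _×_; _,_; ∃)
open import Data.Sum using (_⊎_)
open import Relation.Nullary using (¬_; Dec; yes; no; _×-dec_; _⊎-dec_)
open import Relation.Nullary.Decidable using (⌊_⌋)
open import Relation.Binary using (DecidableEquality)
open import Relation.Binary.PropositionalEquality using (_≡_; _≢_)

-- Binary vectors F^m, F = Z_2 (false = 0, true = 1)

Word : ℕ → Set
Word m = Vec Bool m

_≟w_ : ∀ {m} → DecidableEquality (Word m)
_≟w_ = VecP.≡-dec BoolP._≟_

_⊕_ : ∀ {m} → Word m → Word m → Word m
_⊕_ = zipWith _xor_

𝟎 : ∀ {m} → Word m
𝟎 = replicate _ false

𝟏 : ∀ {m} → Word m
𝟏 = replicate _ true

act : ∀ {m} → Permutation′ m → Word m → Word m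
act π v = tabulate (λ i → lookup v (π ⟨$⟩ˡ i))

ΣFin : (m : ℕ) → (Fin m → ℤ) → ℤ
ΣFin m f = foldr ℤ._+_ (+ 0) (map f (allFin m))

IsHadamardMatrix : (m : ℕ) → (Fin m → Fin m → ℤ) → Set
IsHadamardMatrix m H =
  (∀ i j → H i j ≡ + 1 ⊎ H i j ≡ -[1+ 0 ]) ×
  (∀ i j → ΣFin m (λ k → H i k ℤ.* H j k)
           ≡ (if ⌊ i FinP.≟ j ⌋ then + m else + 0))

toBit : ℤ → Bool
toBit (+ _)    = false
toBit -[1+ _ ] = true

binRow : ∀ {m} → (Fin m → Fin m → ℤ) → Fin m → Word m
binRow H i = tabulate (λ k → toBit (H i k))

IsBinaryHadamardCode : (m : ℕ) → List (Word m) → Set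
IsBinaryHadamardCode m C =
  Unique C ×
  Σ (Fin m → Fin m → ℤ) λ H → IsHadamardMatrix m H ×
    (∀ x → (x ∈ C → ∃ λ i → x ≡ binRow H i ⊎ x ≡ 𝟏 ⊕ binRow H i) ×
           ((∃ λ i → x ≡ binRow H i ⊎ x ≡ 𝟏 ⊕ binRow H i) → x ∈ C))

prodP : ∀ {m} → (Word m → Permutation′ m) → Word m → Word m → Word m
prodP π x y = x ⊕ act (π x) y

IsPropelinear : ∀ {m} → List (Word m) → (Word m → Permutation′ m) → Set
IsPropelinear {m} C π =
  𝟎 ∈ C ×
  (∀ x y → x ∈ C → y ∈ C →
     (prodP π x y ∈ C) ×
     (∀ (i : Fin m) → π x ⟨$⟩ʳ (π y ⟨$⟩ʳ i) ≡ π (prodP π x y) ⟨$⟩ʳ i))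

IsHFPCode : (n : ℕ) → List (Word (4 * n)) → (Word (4 * n) → Permutation′ (4 * n)) → Set
IsHFPCode n C π =
  IsPropelinear C π ×
  IsBinaryHadamardCode (4 * n) C ×
  (∀ i → π 𝟎 ⟨$⟩ʳ i ≡ i) ×
  (∀ i → π 𝟏 ⟨$⟩ʳ i ≡ i) ×
  (∀ a → a ∈ C → a ≢ 𝟎 → a ≢ 𝟏 → ∀ i → π a ⟨$⟩ʳ i ≢ i)

-- Left Hadamard groups, for a finite group given by a duplicate-free list G
-- of its elements, a binary operation, an identity e, and subsets as lists.

module _ {A : Set} (_≟_ : DecidableEquality A) where
  open DecMem _≟_ using (_∈?_)

  IsFiniteGroup : List A → (A → A → A) → A → Set
  IsFiniteGroup G _∙_ e =
    Unique G ×
    e ∈ G ×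
    (∀ x y → x ∈ G → y ∈ G → (x ∙ y) ∈ G) ×
    (∀ x y z → x ∈ G → y ∈ G → z ∈ G → (x ∙ y) ∙ z ≡ x ∙ (y ∙ z)) ×
    (∀ x → x ∈ G → (e ∙ x ≡ x) × (x ∙ e ≡ x)) ×
    (∀ x → x ∈ G → ∃ λ y → y ∈ G × (x ∙ y ≡ e) × (y ∙ x ≡ e))

  ∣aD∩D∣ : List A → (A → A → A) → List A → A → ℕ
  ∣aD∩D∣ G _∙_ D a = length (filter (λ y → (y ∈? map (a ∙_) D) ×-dec (y ∈? D)) G)

  ∣aD∩bbu∣ : List A → (A → A → A) → List A → A → A → A → ℕ
  ∣aD∩bbu∣ G _∙_ D u a b =
    length (filter (λ y → (y ∈? map (a ∙_) D) ×-dec ((y ≟ b) ⊎-dec (y ≟ (b ∙ u)))) G)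

  IsLeftHadamardGroup : (n : ℕ) → (G : List A) → (_∙_ : A → A → A) → (e : A) →
                        (D : List A) → (u : A) → Set
  IsLeftHadamardGroup n G _∙_ e D u =
    IsFiniteGroup G _∙_ e ×
    length G ≡ 8 * n ×
    Unique D × All (_∈ G) D × length D ≡ 4 * n ×
    u ∈ G × u ≢ e × (u ∙ u ≡ e) × (∀ g → g ∈ G → g ∙ u ≡ u ∙ g) ×
    (∀ a → a ∈ G → a ≢ e → a ≢ u → ∣aD∩D∣ G _∙_ D a ≡ 2 * n) ×
    (∀ a b → a ∈ G → b ∈ G → ∣aD∩bbu∣ G _∙_ D u a b ≡ 1)

firstIs0? : ∀ {m} (x : Word (suc m)) → Dec (head x ≡ false)
firstIs0? x = head x BoolP.≟ false

D₁ : ∀ {m} → List (Word (suc m)) → List (Word (suc m))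
D₁ C = filter firstIs0? C

module Submission where

open import Data.Bool using (Bool; true; false; _xor_; not; if_then_else_)
import Data.Bool.Properties as BoolP
open import Data.Nat as ℕ using (ℕ; zero; suc; _≤_; z≤n; s≤s)
import Data.Nat.Properties as ℕP
open import Data.Fin using (Fin; zero; suc; punchIn; punchOut)
import Data.Fin.Properties as FinP
open import Data.Fin.Permutation using (Permutation′; _⟨$⟩ʳ_; _⟨$⟩ˡ_; inverseˡ; inverseʳ)
open import Data.Vec as Vec using (lookup; head; _∷_; replicate)
import Data.Vec.Properties as VecP
open import Data.List using (List; []; _∷_; _++_; length; filter; map; foldr; tabulate; allFin; cartesianProductWith)
import Data.List.Properties as ListP
open import Data.List.Relation.Unary.Any using (here; there)
open import Data.List.Relation.Unary.All as All using (All; []; _∷_)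
open import Data.List.Relation.Unary.Unique.Propositional using (Unique; []; _∷_)
import Data.List.Relation.Unary.Unique.Propositional.Properties as UniqueP
open import Data.List.Membership.Propositional using (_∈_)
import Data.List.Membership.Propositional.Properties as ∈P
open import Data.List.Membership.Propositional.Properties.WithK using (unique∧set⇒bag)
import Data.List.Membership.DecPropositional as DecMembership
open import Data.List.Relation.Binary.Subset.Propositional using (_⊆_)
open import Data.List.Relation.Binary.BagAndSetEquality using (∼bag⇒↭)
open import Data.List.Relation.Binary.Permutation.Propositional using (_↭_)
open import Data.List.Relation.Binary.Permutation.Propositional.Properties using (↭-length; filter-↭)
open import Data.Product as Product using (_×_; _,_; proj₁; proj₂; ∃)
open import Data.Product.Function.NonDependent.Propositional using (_×-⇔_)
open import Data.Sum using (_⊎_; inj₁; inj₂; reduce)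
open import Function using (_∘_; _⇔_; mk⇔; Equivalence)
open import Relation.Nullary using (¬_; Dec; yes; no; _×-dec_; contradiction)
open import Relation.Nullary.Decidable using (⌊_⌋; isYes≗does; dec-true; dec-false)
open import Relation.Unary using (Decidable)
open import Relation.Binary using (DecidableEquality)
open import Relation.Binary.PropositionalEquality
open import Data.Integer using (ℤ)
open import Defs

-- Propelinear codes are groups: associativity comes from π_x π_y = π_{x·y}, and
-- left translation by x is injective on the finite set C, hence onto, which gives
-- inverses.  Since π_x fixes 𝟏, x·𝟏 = x + 𝟏 complements every coordinate, so of b and
-- b·𝟏 exactly one lies in aD₁ = {y | (a⁻¹y)₁ = 0}: this is condition (ii).
-- For (i) write (a⁻¹y)₁ = (a⁻¹)₁ + y_j with j = π_{a⁻¹}⁻¹(1).  As π_{a⁻¹} has no fixed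
-- point, j ≠ 1, and aD₁ ∩ D₁ consists of the codewords with prescribed values in the two
-- distinct coordinates 1 and j.  A row of the Hadamard matrix together with its
-- complement contributes one such codeword exactly when the row's entries in columns 1
-- and j have a prescribed product; distinct columns of a Hadamard matrix being
-- orthogonal, this happens for exactly half of the 4n rows.

module _ {A : Set} where

  ∈-++-skip : ∀ {x y : A} xs ys → x ∈ xs ++ y ∷ ys → x ≢ y → x ∈ xs ++ ys
  ∈-++-skip []       ys (here x≡y) x≢y = contradiction x≡y x≢y
  ∈-++-skip []       ys (there x∈) _   = x∈
  ∈-++-skip (_ ∷ xs) ys (here x≡z) _   = here x≡z
  ∈-++-skip (_ ∷ xs) ys (there x∈) x≢y = there (∈-++-skip xs ys x∈ x≢y)

  Unique-⊆⇒length≤ : ∀ {xs ys : List A} → Unique xs → xs ⊆ ys → length xs ≤ length ys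
  Unique-⊆⇒length≤ {[]}     _ _ = z≤n
  Unique-⊆⇒length≤ {x ∷ xs} {ys} (x∉xs ∷ uxs) xs⊆ys
    with us , vs , refl ← ∈P.∈-∃++ (xs⊆ys (here refl)) = begin
      suc (length xs)                ≤⟨ s≤s (Unique-⊆⇒length≤ uxs xs⊆us++vs) ⟩
      suc (length (us ++ vs))        ≡⟨ cong suc (ListP.length-++ us) ⟩
      suc (length us ℕ.+ length vs)  ≡⟨ ℕP.+-suc (length us) (length vs) ⟨
      length us ℕ.+ length (x ∷ vs)  ≡⟨ ListP.length-++ us ⟨
      length (us ++ x ∷ vs)          ∎
    where
    open ℕP.≤-Reasoning
    xs⊆us++vs : xs ⊆ us ++ vs
    xs⊆us++vs z∈xs = ∈-++-skip us vs (xs⊆ys (there z∈xs)) (λ z≡x → All.lookup x∉xs z∈xs (sym z≡x))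

  Unique-⊆-length≥⇒⊇ : DecidableEquality A → ∀ {xs ys : List A} → Unique xs → xs ⊆ ys →
                       length ys ≤ length xs → ys ⊆ xs
  Unique-⊆-length≥⇒⊇ _≟_ {xs} {ys} uxs xs⊆ys ys≤xs {y} y∈ys with DecMembership._∈?_ _≟_ y xs
  ... | yes y∈xs = y∈xs
  ... | no  y∉xs = contradiction (ℕP.≤-trans (Unique-⊆⇒length≤ (fresh ∷ uxs) y∷xs⊆ys) ys≤xs) ℕP.1+n≰n
    where
    fresh : All (y ≢_) xs
    fresh = All.tabulate λ x∈xs y≡x → y∉xs (subst (_∈ xs) (sym y≡x) x∈xs)
    y∷xs⊆ys : y ∷ xs ⊆ ys
    y∷xs⊆ys (here refl) = y∈ys
    y∷xs⊆ys (there x∈)  = xs⊆ys x∈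

  Unique-same-elements⇒↭ : ∀ {xs ys : List A} → Unique xs → Unique ys →
                           (∀ {x} → x ∈ xs ⇔ x ∈ ys) → xs ↭ ys
  Unique-same-elements⇒↭ uxs uys xs≈ys = ∼bag⇒↭ (unique∧set⇒bag uxs uys xs≈ys)

  length-filter-cong : ∀ {P Q : A → Set} (P? : Decidable P) (Q? : Decidable Q) xs →
                       (∀ {x} → x ∈ xs → P x ⇔ Q x) → length (filter P? xs) ≡ length (filter Q? xs)
  length-filter-cong P? Q? []       _   = refl
  length-filter-cong P? Q? (x ∷ xs) P⇔Q with P? x | Q? x
  ... | yes _  | yes _  = cong suc (length-filter-cong P? Q? xs (P⇔Q ∘ there))
  ... | no  _  | no  _  = length-filter-cong P? Q? xs (P⇔Q ∘ there)
  ... | yes px | no ¬qx = contradiction (Equivalence.to (P⇔Q (here refl)) px) ¬qx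
  ... | no ¬px | yes qx = contradiction (Equivalence.from (P⇔Q (here refl)) qx) ¬px

  length-filter≡1 : ∀ {P : A → Set} (P? : Decidable P) {w} {xs} → Unique xs → w ∈ xs →
                    (∀ {y} → y ∈ xs → P y ⇔ y ≡ w) → length (filter P? xs) ≡ 1
  length-filter≡1 P? {w} {x ∷ xs} (x∉xs ∷ uxs) w∈ P⇔≡w with P? x | w∈
  ... | yes px | _          = cong (suc ∘ length) (ListP.filter-none P? (All.tabulate ¬P))
    where
    ¬P : ∀ {y} → y ∈ xs → ¬ _
    ¬P {y} y∈xs py = All.lookup x∉xs y∈xs
      (trans (Equivalence.to (P⇔≡w (here refl)) px) (sym (Equivalence.to (P⇔≡w (there y∈xs)) py)))
  ... | no ¬px | here w≡x   = contradiction (Equivalence.from (P⇔≡w (here refl)) (sym w≡x)) ¬px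
  ... | no _   | there w∈xs = length-filter≡1 P? uxs w∈xs (P⇔≡w ∘ there)

length-filter-map : ∀ {A B : Set} {P : B → Set} (P? : Decidable P) (f : A → B) xs →
                    length (filter P? (map f xs)) ≡ length (filter (P? ∘ f) xs)
length-filter-map P? f []       = refl
length-filter-map P? f (x ∷ xs) with P? (f x)
... | yes _ = cong suc (length-filter-map P? f xs)
... | no _  = length-filter-map P? f xs

length-cartesianProductWith : ∀ {A B C : Set} (f : A → B → C) xs ys →
                              length (cartesianProductWith f xs ys) ≡ length xs ℕ.* length ys
length-cartesianProductWith f []       ys = refl
length-cartesianProductWith f (x ∷ xs) ys = begin
  length (map (f x) ys ++ cartesianProductWith f xs ys)            ≡⟨ ListP.length-++ (map (f x) ys) ⟩
  length (map (f x) ys) ℕ.+ length (cartesianProductWith f xs ys)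
    ≡⟨ cong₂ ℕ._+_ (ListP.length-map (f x) ys) (length-cartesianProductWith f xs ys) ⟩
  length ys ℕ.+ length xs ℕ.* length ys                            ∎
  where open ≡-Reasoning

xor≡false⇔≡ : ∀ {x y} → x xor y ≡ false ⇔ x ≡ y
xor≡false⇔≡ {x} = mk⇔ to (λ { refl → BoolP.xor-same x })
  where
  to : ∀ {x y} → x xor y ≡ false → x ≡ y
  to {false} {false} _ = refl
  to {true}  {true}  _ = refl

xor-transpose : ∀ a b c d → a xor b ≡ c xor d → b xor d ≡ a xor c
xor-transpose false b false d refl = BoolP.xor-same b
xor-transpose false b true  d refl = BoolP.xor-inverseˡ d
xor-transpose true  b false d refl = BoolP.xor-inverseʳ b
xor-transpose true  b true  d ¬b≡¬d rewrite BoolP.not-injective ¬b≡¬d = BoolP.xor-same d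

not≡false⇔≢false : ∀ {x} → not x ≡ false ⇔ (¬ x ≡ false)
not≡false⇔≢false {false} = mk⇔ (λ ()) (λ x≢false → contradiction refl x≢false)
not≡false⇔≢false {true}  = mk⇔ (λ _ ()) (λ _ → refl)

module _ {m : ℕ} where

  lookup-ext : ∀ {u v : Word m} → (∀ i → lookup u i ≡ lookup v i) → u ≡ v
  lookup-ext {u} {v} u≗v = begin
    u                       ≡⟨ VecP.tabulate∘lookup u ⟨
    Vec.tabulate (lookup u) ≡⟨ VecP.tabulate-cong u≗v ⟩
    Vec.tabulate (lookup v) ≡⟨ VecP.tabulate∘lookup v ⟩
    v                       ∎
    where open ≡-Reasoning

  lookup-⊕ : ∀ (u v : Word m) i → lookup (u ⊕ v) i ≡ lookup u i xor lookup v i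
  lookup-⊕ u v i = VecP.lookup-zipWith _xor_ i u v

  lookup-𝟎 : ∀ i → lookup (𝟎 {m}) i ≡ false
  lookup-𝟎 i = VecP.lookup-replicate i false

  lookup-𝟏 : ∀ i → lookup (𝟏 {m}) i ≡ true
  lookup-𝟏 i = VecP.lookup-replicate i true

  lookup-𝟏⊕ : ∀ (u : Word m) i → lookup (𝟏 ⊕ u) i ≡ not (lookup u i)
  lookup-𝟏⊕ u i = trans (lookup-⊕ 𝟏 u i) (cong (_xor lookup u i) (lookup-𝟏 i))

  lookup-act : ∀ (π : Permutation′ m) v i → lookup (act π v) i ≡ lookup v (π ⟨$⟩ˡ i)
  lookup-act π v i = VecP.lookup∘tabulate _ i

  ⊕-assoc : ∀ (u v w : Word m) → (u ⊕ v) ⊕ w ≡ u ⊕ (v ⊕ w)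
  ⊕-assoc u v w = lookup-ext λ i → begin
    lookup ((u ⊕ v) ⊕ w) i                        ≡⟨ lookup-⊕ (u ⊕ v) w i ⟩
    lookup (u ⊕ v) i xor lookup w i               ≡⟨ cong (_xor lookup w i) (lookup-⊕ u v i) ⟩
    (lookup u i xor lookup v i) xor lookup w i    ≡⟨ BoolP.xor-assoc (lookup u i) (lookup v i) (lookup w i) ⟩
    lookup u i xor (lookup v i xor lookup w i)    ≡⟨ cong (lookup u i xor_) (lookup-⊕ v w i) ⟨
    lookup u i xor lookup (v ⊕ w) i               ≡⟨ lookup-⊕ u (v ⊕ w) i ⟨
    lookup (u ⊕ (v ⊕ w)) i                        ∎
    where open ≡-Reasoning

  ⊕-comm : ∀ (u v : Word m) → u ⊕ v ≡ v ⊕ u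
  ⊕-comm u v = lookup-ext λ i →
    trans (lookup-⊕ u v i) (trans (BoolP.xor-comm (lookup u i) (lookup v i)) (sym (lookup-⊕ v u i)))

  ⊕-identityˡ : ∀ (u : Word m) → 𝟎 ⊕ u ≡ u
  ⊕-identityˡ u = lookup-ext λ i → trans (lookup-⊕ 𝟎 u i) (cong (_xor lookup u i) (lookup-𝟎 i))

  ⊕-identityʳ : ∀ (u : Word m) → u ⊕ 𝟎 ≡ u
  ⊕-identityʳ u = trans (⊕-comm u 𝟎) (⊕-identityˡ u)

  ⊕-self : ∀ (u : Word m) → u ⊕ u ≡ 𝟎
  ⊕-self u = lookup-ext λ i →
    trans (lookup-⊕ u u i) (trans (BoolP.xor-same (lookup u i)) (sym (lookup-𝟎 i)))

  ⊕-self-cancelˡ : ∀ (u v : Word m) → u ⊕ (u ⊕ v) ≡ v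
  ⊕-self-cancelˡ u v = trans (sym (⊕-assoc u u v)) (trans (cong (_⊕ v) (⊕-self u)) (⊕-identityˡ v))

  ⊕-cancelˡ : ∀ (u : Word m) {v w} → u ⊕ v ≡ u ⊕ w → v ≡ w
  ⊕-cancelˡ u {v} {w} u⊕v≡u⊕w =
    trans (sym (⊕-self-cancelˡ u v)) (trans (cong (u ⊕_) u⊕v≡u⊕w) (⊕-self-cancelˡ u w))

  act-⊕ : ∀ (π : Permutation′ m) u v → act π (u ⊕ v) ≡ act π u ⊕ act π v
  act-⊕ π u v = lookup-ext λ i → begin
    lookup (act π (u ⊕ v)) i                     ≡⟨ lookup-act π (u ⊕ v) i ⟩
    lookup (u ⊕ v) (π ⟨$⟩ˡ i)                    ≡⟨ lookup-⊕ u v (π ⟨$⟩ˡ i) ⟩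
    lookup u (π ⟨$⟩ˡ i) xor lookup v (π ⟨$⟩ˡ i)  ≡⟨ cong₂ _xor_ (lookup-act π u i) (lookup-act π v i) ⟨
    lookup (act π u) i xor lookup (act π v) i    ≡⟨ lookup-⊕ (act π u) (act π v) i ⟨
    lookup (act π u ⊕ act π v) i                 ∎
    where open ≡-Reasoning

  act-𝟎 : ∀ (π : Permutation′ m) → act π 𝟎 ≡ 𝟎
  act-𝟎 π = lookup-ext λ i → trans (lookup-act π 𝟎 i) (trans (lookup-𝟎 _) (sym (lookup-𝟎 i)))

  act-𝟏 : ∀ (π : Permutation′ m) → act π 𝟏 ≡ 𝟏
  act-𝟏 π = lookup-ext λ i → trans (lookup-act π 𝟏 i) (trans (lookup-𝟏 _) (sym (lookup-𝟏 i)))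

  act-id : ∀ (π : Permutation′ m) → (∀ i → π ⟨$⟩ʳ i ≡ i) → ∀ v → act π v ≡ v
  act-id π π≗id v = lookup-ext λ i →
    trans (lookup-act π v i) (cong (lookup v) (trans (cong (π ⟨$⟩ˡ_) (sym (π≗id i))) (inverseˡ π)))

  act-∘ : ∀ (π ρ σ : Permutation′ m) → (∀ i → π ⟨$⟩ʳ (ρ ⟨$⟩ʳ i) ≡ σ ⟨$⟩ʳ i) →
          ∀ v → act π (act ρ v) ≡ act σ v
  act-∘ π ρ σ πρ≗σ v = lookup-ext λ i → begin
    lookup (act π (act ρ v)) i       ≡⟨ lookup-act π (act ρ v) i ⟩
    lookup (act ρ v) (π ⟨$⟩ˡ i)      ≡⟨ lookup-act ρ v (π ⟨$⟩ˡ i) ⟩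
    lookup v (ρ ⟨$⟩ˡ (π ⟨$⟩ˡ i))     ≡⟨ cong (lookup v) (inverse-∘ i) ⟩
    lookup v (σ ⟨$⟩ˡ i)              ≡⟨ lookup-act σ v i ⟨
    lookup (act σ v) i               ∎
    where
    open ≡-Reasoning
    inverse-∘ : ∀ i → ρ ⟨$⟩ˡ (π ⟨$⟩ˡ i) ≡ σ ⟨$⟩ˡ i
    inverse-∘ i = begin
      ρ ⟨$⟩ˡ (π ⟨$⟩ˡ i)                         ≡⟨ inverseˡ σ ⟨
      σ ⟨$⟩ˡ (σ ⟨$⟩ʳ (ρ ⟨$⟩ˡ (π ⟨$⟩ˡ i)))       ≡⟨ cong (σ ⟨$⟩ˡ_) (πρ≗σ _) ⟨
      σ ⟨$⟩ˡ (π ⟨$⟩ʳ (ρ ⟨$⟩ʳ (ρ ⟨$⟩ˡ (π ⟨$⟩ˡ i)))) ≡⟨ cong (λ j → σ ⟨$⟩ˡ (π ⟨$⟩ʳ j)) (inverseʳ ρ) ⟩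
      σ ⟨$⟩ˡ (π ⟨$⟩ʳ (π ⟨$⟩ˡ i))                ≡⟨ cong (σ ⟨$⟩ˡ_) (inverseʳ π) ⟩
      σ ⟨$⟩ˡ i                                  ∎

  act-injective : ∀ (π : Permutation′ m) {u v} → act π u ≡ act π v → u ≡ v
  act-injective π {u} {v} πu≡πv = lookup-ext λ i → begin
    lookup u i                       ≡⟨ cong (lookup u) (inverseˡ π) ⟨
    lookup u (π ⟨$⟩ˡ (π ⟨$⟩ʳ i))     ≡⟨ lookup-act π u (π ⟨$⟩ʳ i) ⟨
    lookup (act π u) (π ⟨$⟩ʳ i)      ≡⟨ cong (λ w → lookup w (π ⟨$⟩ʳ i)) πu≡πv ⟩
    lookup (act π v) (π ⟨$⟩ʳ i)      ≡⟨ lookup-act π v (π ⟨$⟩ʳ i) ⟩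
    lookup v (π ⟨$⟩ˡ (π ⟨$⟩ʳ i))     ≡⟨ cong (lookup v) (inverseˡ π) ⟩
    lookup v i                       ∎
    where open ≡-Reasoning

head≡lookup-zero : ∀ {m} (x : Word (suc m)) → head x ≡ lookup x zero
head≡lookup-zero (_ ∷ _) = refl

head≡⇔lookup-zero≡ : ∀ {m} (x : Word (suc m)) {b} → head x ≡ b ⇔ lookup x zero ≡ b
head≡⇔lookup-zero≡ x = mk⇔ (trans (sym (head≡lookup-zero x))) (trans (head≡lookup-zero x))

coordinate? : ∀ {m} (c : Fin m) (b : Bool) → Decidable (λ (y : Word m) → lookup y c ≡ b)
coordinate? c b y = lookup y c BoolP.≟ b

coordinates? : ∀ {m} (c : Fin m) (b : Bool) (j : Fin m) (b′ : Bool) →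
               Decidable (λ (y : Word m) → lookup y c ≡ b × lookup y j ≡ b′)
coordinates? c b j b′ y = coordinate? c b y ×-dec coordinate? j b′ y

-- Hadamard matrices and their codes

module Hadamard where

  open import Data.Integer as ℤ using (ℤ; +_; -[1+_]; 0ℤ; _+_; _*_; +≤+)
  import Data.Integer.Properties as ℤP
  open import Data.Integer.Tactic.RingSolver using (solve-∀)
  open import Algebra.Properties.Semiring.Sum ℤP.+-*-semiring
  open import Algebra.Properties.AbelianGroup ℤP.+-0-abelianGroup using () renaming (∙-cancelˡ to +-cancelˡ)

  length-filter-cartesianProductWith : ∀ {A B C : Set} {P : C → Set} (P? : Decidable P) (f : A → B → C)
    {n} (g : Fin n → A) ys →
    + length (filter P? (cartesianProductWith f (tabulate g) ys)) ≡ ∑[ i < n ] (+ length (filter (P? ∘ f (g i)) ys))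
  length-filter-cartesianProductWith P? f {zero}  g ys = refl
  length-filter-cartesianProductWith P? f {suc n} g ys = begin
    + length (filter P? (map (f (g zero)) ys ++ rest))
      ≡⟨ cong (+_ ∘ length) (ListP.filter-++ P? (map (f (g zero)) ys) rest) ⟩
    + length (filter P? (map (f (g zero)) ys) ++ filter P? rest)
      ≡⟨ cong +_ (ListP.length-++ (filter P? (map (f (g zero)) ys))) ⟩
    + length (filter P? (map (f (g zero)) ys)) + + length (filter P? rest)
      ≡⟨ cong₂ _+_ (cong +_ (length-filter-map P? (f (g zero)) ys))
                   (length-filter-cartesianProductWith P? f (g ∘ suc) ys) ⟩
    ∑[ i < suc n ] (+ length (filter (P? ∘ f (g i)) ys)) ∎
    where
    open ≡-Reasoning
    rest = cartesianProductWith f (tabulate (g ∘ suc)) ys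

  ΣFin≡∑ : ∀ n (f : Fin n → ℤ) → ΣFin n f ≡ ∑[ i < n ] f i
  ΣFin≡∑ n f = trans (cong (foldr _+_ (+ 0)) (ListP.map-tabulate (λ i → i) f)) (foldr-tabulate n f)
    where
    foldr-tabulate : ∀ n (f : Fin n → ℤ) → foldr _+_ (+ 0) (tabulate f) ≡ ∑[ i < n ] f i
    foldr-tabulate zero    f = refl
    foldr-tabulate (suc n) f = cong (_+_ (f zero)) (foldr-tabulate n (f ∘ suc))

  ∑-const : ∀ n x → ∑[ i < n ] x ≡ + n * x
  ∑-const zero    x = sym (ℤP.*-zeroˡ x)
  ∑-const (suc n) x = trans (cong (_+_ x) (∑-const n x)) (sym (ℤP.suc-* (+ n) x))

  0≤∑ : ∀ {n} (f : Fin n → ℤ) → (∀ i → 0ℤ ℤ.≤ f i) → 0ℤ ℤ.≤ ∑[ i < n ] f i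
  0≤∑ {zero}  f _   = +≤+ z≤n
  0≤∑ {suc n} f 0≤f = ℤP.+-mono-≤ (0≤f zero) (0≤∑ (f ∘ suc) (0≤f ∘ suc))

  nonneg+nonneg≡0 : ∀ {i j} → 0ℤ ℤ.≤ i → 0ℤ ℤ.≤ j → i + j ≡ 0ℤ → i ≡ 0ℤ × j ≡ 0ℤ
  nonneg+nonneg≡0 {+ p} {+ q} (+≤+ _) (+≤+ _) i+j≡0 =
    cong +_ (ℕP.m+n≡0⇒m≡0 p p+q≡0) , cong +_ (ℕP.m+n≡0⇒n≡0 p p+q≡0)
    where
    p+q≡0 = ℤP.+-injective i+j≡0

  ∑-nonneg≡0 : ∀ {n} (f : Fin n → ℤ) → (∀ i → 0ℤ ℤ.≤ f i) → ∑[ i < n ] f i ≡ 0ℤ → ∀ i → f i ≡ 0ℤ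
  ∑-nonneg≡0 {suc n} f 0≤f ∑≡0
    with f₀≡0 , ∑rest≡0 ← nonneg+nonneg≡0 (0≤f zero) (0≤∑ (f ∘ suc) (0≤f ∘ suc)) ∑≡0 = λ where
      zero    → f₀≡0
      (suc i) → ∑-nonneg≡0 (f ∘ suc) (0≤f ∘ suc) ∑rest≡0 i

  0≤i*i : ∀ i → 0ℤ ℤ.≤ i * i
  0≤i*i (+ n)    = subst (0ℤ ℤ.≤_) (ℤP.pos-* n n) (+≤+ z≤n)
  0≤i*i -[1+ n ] = +≤+ z≤n

  ∑-squares≡0 : ∀ {n} (f : Fin n → ℤ) → ∑[ i < n ] (f i * f i) ≡ 0ℤ → ∀ i → f i ≡ 0ℤ
  ∑-squares≡0 f ∑≡0 i = reduce (ℤP.i*j≡0⇒i≡0∨j≡0 (f i) (∑-nonneg≡0 _ (0≤i*i ∘ f) ∑≡0 i))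

  δ : ∀ {n} → Fin n → Fin n → ℤ → ℤ
  δ i j x = if ⌊ i FinP.≟ j ⌋ then x else 0ℤ

  ∑-δ : ∀ {n} (f : Fin (suc n) → ℤ) i x → ∑[ j < suc n ] (f j * δ i j x) ≡ f i * x
  ∑-δ {n} f i x = begin
    ∑[ j < suc n ] (f j * δ i j x)                      ≡⟨ sum-remove {i = i} (λ j → f j * δ i j x) ⟩
    f i * δ i i x + ∑[ j < n ] (f (p j) * δ i (p j) x)  ≡⟨ cong₂ (λ d s → f i * d + s) diag (sum-cong-≗ off) ⟩
    f i * x + ∑[ j < n ] 0ℤ                             ≡⟨ cong (_+_ (f i * x)) (∑-const n 0ℤ) ⟩
    f i * x + + n * 0ℤ                                  ≡⟨ cong (_+_ (f i * x)) (ℤP.*-zeroʳ (+ n)) ⟩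
    f i * x + 0ℤ                                        ≡⟨ ℤP.+-identityʳ (f i * x) ⟩
    f i * x                                             ∎
    where
    open ≡-Reasoning
    p = punchIn i
    diag : δ i i x ≡ x
    diag = cong (if_then x else 0ℤ) (trans (isYes≗does (i FinP.≟ i)) (dec-true (i FinP.≟ i) refl))
    off : ∀ j → f (p j) * δ i (p j) x ≡ 0ℤ
    off j = trans (cong (λ b → f (p j) * (if b then x else 0ℤ))
                        (trans (isYes≗does (i FinP.≟ p j)) (dec-false (i FinP.≟ p j) (FinP.punchInᵢ≢i i j ∘ sym))))
                  (ℤP.*-zeroʳ (f (p j)))

  signed : Bool → ℤ
  signed false = + 1
  signed true  = -[1+ 0 ]

  signed-xor : ∀ x y → signed (x xor y) ≡ signed x * signed y
  signed-xor false false = refl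
  signed-xor false true  = refl
  signed-xor true  false = refl
  signed-xor true  true  = refl

  module HadamardMatrix {n} {H : Fin (suc n) → Fin (suc n) → ℤ} (isHadamard : IsHadamardMatrix (suc n) H) where

    entry≡signed : ∀ i k → H i k ≡ signed (toBit (H i k))
    entry≡signed i k with proj₁ isHadamard i k
    ... | inj₁ Hik≡1  rewrite Hik≡1  = refl
    ... | inj₂ Hik≡-1 rewrite Hik≡-1 = refl

    entry*entry : ∀ i k i′ k′ → H i k * H i′ k′ ≡ signed (toBit (H i k) xor toBit (H i′ k′))
    entry*entry i k i′ k′ = begin
      H i k * H i′ k′                                   ≡⟨ cong₂ _*_ (entry≡signed i k) (entry≡signed i′ k′) ⟩
      signed (toBit (H i k)) * signed (toBit (H i′ k′)) ≡⟨ signed-xor (toBit (H i k)) (toBit (H i′ k′)) ⟨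
      signed (toBit (H i k) xor toBit (H i′ k′))        ∎
      where open ≡-Reasoning

    entry² : ∀ i k → H i k * H i k ≡ + 1
    entry² i k = trans (entry*entry i k i k) (cong signed (BoolP.xor-same (toBit (H i k))))

    rows-orthogonal : ∀ i i′ → ∑[ k < suc n ] (H i k * H i′ k) ≡ δ i i′ (+ suc n)
    rows-orthogonal i i′ = trans (sym (ΣFin≡∑ (suc n) (λ k → H i k * H i′ k))) (proj₂ isHadamard i i′)

    transpose-norm : ∀ (x : Fin (suc n) → ℤ) →
      ∑[ j < suc n ] ((∑[ i < suc n ] (x i * H i j)) * (∑[ i < suc n ] (x i * H i j)))
        ≡ + suc n * ∑[ i < suc n ] (x i * x i)
    transpose-norm x = begin
      ∑[ j < m ] ((∑[ i < m ] (x i * H i j)) * (∑[ i < m ] (x i * H i j)))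
        ≡⟨ sum-cong-≗ (λ j → trans (*-distribʳ-sum _ (λ i → x i * H i j))
                                   (sum-cong-≗ λ i → *-distribˡ-sum (x i * H i j) (λ i′ → x i′ * H i′ j))) ⟩
      ∑[ j < m ] ∑[ i < m ] ∑[ i′ < m ] ((x i * H i j) * (x i′ * H i′ j))
        ≡⟨ ∑-comm (λ j i → ∑[ i′ < m ] ((x i * H i j) * (x i′ * H i′ j))) ⟩
      ∑[ i < m ] ∑[ j < m ] ∑[ i′ < m ] ((x i * H i j) * (x i′ * H i′ j))
        ≡⟨ sum-cong-≗ (λ i → ∑-comm (λ j i′ → (x i * H i j) * (x i′ * H i′ j))) ⟩
      ∑[ i < m ] ∑[ i′ < m ] ∑[ j < m ] ((x i * H i j) * (x i′ * H i′ j))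
        ≡⟨ sum-cong-≗ (λ i → sum-cong-≗ λ i′ → trans (sum-cong-≗ λ j → rearrange (x i) (H i j) (x i′) (H i′ j))
                                                    (sym (*-distribˡ-sum (x i * x i′) (λ j → H i j * H i′ j)))) ⟩
      ∑[ i < m ] ∑[ i′ < m ] ((x i * x i′) * ∑[ j < m ] (H i j * H i′ j))
        ≡⟨ sum-cong-≗ (λ i → trans (sum-cong-≗ λ i′ → cong (_*_ (x i * x i′)) (rows-orthogonal i i′))
                                   (∑-δ (λ i′ → x i * x i′) i (+ m))) ⟩
      ∑[ i < m ] ((x i * x i) * + m)
        ≡⟨ *-distribʳ-sum (+ m) (λ i → x i * x i) ⟨
      ∑[ i < m ] (x i * x i) * + m
        ≡⟨ ℤP.*-comm _ (+ m) ⟩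
      + m * ∑[ i < m ] (x i * x i) ∎
      where
      open ≡-Reasoning
      m = suc n
      rearrange : ∀ a b c d → (a * b) * (c * d) ≡ (a * c) * (b * d)
      rearrange = solve-∀

    -- Hᵀ multiplies squared norms by m; for the column c of H this is m², which is already
    -- the square of the c-th entry of Hᵀ(column c), so all its other entries vanish.
    columns-orthogonal : ∀ {c j} → c ≢ j → ∑[ i < suc n ] (H i c * H i j) ≡ 0ℤ
    columns-orthogonal {c} {j} c≢j =
      subst (λ j → v j ≡ 0ℤ) (FinP.punchIn-punchOut c≢j)
        (∑-squares≡0 (v ∘ punchIn c) off-diagonal≡0 (punchOut c≢j))
      where
      v : Fin (suc n) → ℤ
      v j = ∑[ i < suc n ] (H i c * H i j)
      v-diag : v c ≡ + suc n
      v-diag = trans (sum-cong-≗ (λ i → entry² i c)) (trans (∑-const (suc n) (+ 1)) (ℤP.*-identityʳ (+ suc n)))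
      off-diagonal≡0 : ∑[ j < n ] (v (punchIn c j) * v (punchIn c j)) ≡ 0ℤ
      off-diagonal≡0 = +-cancelˡ (v c * v c) _ 0ℤ (begin
        v c * v c + ∑[ j < n ] (v (punchIn c j) * v (punchIn c j)) ≡⟨ sum-remove {i = c} (λ j → v j * v j) ⟨
        ∑[ j < suc n ] (v j * v j)                                 ≡⟨ transpose-norm (λ i → H i c) ⟩
        + suc n * ∑[ i < suc n ] (H i c * H i c)                   ≡⟨ cong₂ _*_ v-diag refl ⟨
        v c * v c                                                  ≡⟨ ℤP.+-identityʳ (v c * v c) ⟨
        v c * v c + 0ℤ                                             ∎)
        where open ≡-Reasoning

  bits : List Bool
  bits = false ∷ true ∷ []

  bits-xor-count : ∀ x b → length (filter (λ s → s xor x BoolP.≟ b) bits) ≡ 1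
  bits-xor-count false false = refl
  bits-xor-count false true  = refl
  bits-xor-count true  false = refl
  bits-xor-count true  true  = refl

  bits-xor-pair-count : ∀ x y b b′ →
    + (2 ℕ.* length (filter (λ s → (s xor x BoolP.≟ b) ×-dec (s xor y BoolP.≟ b′)) bits))
      ≡ + 1 + signed (x xor y) * signed (b xor b′)
  bits-xor-pair-count false false false false = refl
  bits-xor-pair-count false false false true  = refl
  bits-xor-pair-count false false true  false = refl
  bits-xor-pair-count false false true  true  = refl
  bits-xor-pair-count false true  false false = refl
  bits-xor-pair-count false true  false true  = refl
  bits-xor-pair-count false true  true  false = refl
  bits-xor-pair-count false true  true  true  = refl
  bits-xor-pair-count true  false false false = refl
  bits-xor-pair-count true  false false true  = refl
  bits-xor-pair-count true  false true  false = refl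
  bits-xor-pair-count true  false true  true  = refl
  bits-xor-pair-count true  true  false false = refl
  bits-xor-pair-count true  true  false true  = refl
  bits-xor-pair-count true  true  true  false = refl
  bits-xor-pair-count true  true  true  true  = refl

  module _ {m : ℕ} (H : Fin m → Fin m → ℤ) where

    codeword : Fin m → Bool → Word m
    codeword i s = replicate m s ⊕ binRow H i

    hadamardCode : List (Word m)
    hadamardCode = cartesianProductWith codeword (allFin m) bits

    lookup-codeword : ∀ i s k → lookup (codeword i s) k ≡ s xor toBit (H i k)
    lookup-codeword i s k = trans (lookup-⊕ (replicate m s) (binRow H i) k)
      (cong₂ _xor_ (VecP.lookup-replicate k s) (VecP.lookup∘tabulate _ k))

    lookup-codeword⇔ : ∀ i s k {b} → lookup (codeword i s) k ≡ b ⇔ s xor toBit (H i k) ≡ b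
    lookup-codeword⇔ i s k = mk⇔ (trans (sym (lookup-codeword i s k))) (trans (lookup-codeword i s k))

    ∈-hadamardCode⇔ : ∀ {x} → x ∈ hadamardCode ⇔ (∃ λ i → x ≡ binRow H i ⊎ x ≡ 𝟏 ⊕ binRow H i)
    ∈-hadamardCode⇔ {x} = mk⇔ to from
      where
      to : x ∈ hadamardCode → ∃ λ i → x ≡ binRow H i ⊎ x ≡ 𝟏 ⊕ binRow H i
      to x∈ with ∈P.∈-cartesianProductWith⁻ codeword (allFin m) bits x∈
      ... | i , false , _ , _ , x≡ = i , inj₁ (trans x≡ (⊕-identityˡ (binRow H i)))
      ... | i , true  , _ , _ , x≡ = i , inj₂ x≡
      from : (∃ λ i → x ≡ binRow H i ⊎ x ≡ 𝟏 ⊕ binRow H i) → x ∈ hadamardCode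
      from (i , inj₁ refl) = subst (_∈ hadamardCode) (⊕-identityˡ (binRow H i))
                                   (∈P.∈-cartesianProductWith⁺ codeword (∈P.∈-allFin i) (here refl))
      from (i , inj₂ refl) = ∈P.∈-cartesianProductWith⁺ codeword (∈P.∈-allFin i) (there (here refl))

    length-filter-codeword-coordinate : ∀ i c b → length (filter (coordinate? c b ∘ codeword i) bits) ≡ 1
    length-filter-codeword-coordinate i c b =
      trans (length-filter-cong (coordinate? c b ∘ codeword i) (λ s → s xor toBit (H i c) BoolP.≟ b) bits
                                (λ {s} _ → lookup-codeword⇔ i s c))
            (bits-xor-count (toBit (H i c)) b)

    length-filter-codeword-coordinates : ∀ i c b j b′ →
      + (2 ℕ.* length (filter (coordinates? c b j b′ ∘ codeword i) bits))
        ≡ + 1 + signed (toBit (H i c) xor toBit (H i j)) * signed (b xor b′)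
    length-filter-codeword-coordinates i c b j b′ =
      trans (cong (λ l → + (2 ℕ.* l))
                  (length-filter-cong (coordinates? c b j b′ ∘ codeword i)
                                      (λ s → (s xor x BoolP.≟ b) ×-dec (s xor y BoolP.≟ b′)) bits
                                      (λ {s} _ → lookup-codeword⇔ i s c ×-⇔ lookup-codeword⇔ i s j)))
            (bits-xor-pair-count x y b b′)
      where
      x = toBit (H i c)
      y = toBit (H i j)

  module HadamardCode {n} {H : Fin (suc n) → Fin (suc n) → ℤ} (isHadamard : IsHadamardMatrix (suc n) H) where
    open HadamardMatrix isHadamard

    codeword-injective : ∀ {i i′ s s′} → codeword H i s ≡ codeword H i′ s′ → i ≡ i′ × s ≡ s′
    codeword-injective {i} {i′} {s} {s′} eq = Product.map₂ (Equivalence.to xor≡false⇔≡)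
      (orthogonality-forces (i FinP.≟ i′) (s xor s′) (trans (sym row-product) (rows-orthogonal i i′)))
      where
      bits-agree : ∀ k → s xor toBit (H i k) ≡ s′ xor toBit (H i′ k)
      bits-agree k = trans (sym (lookup-codeword H i s k)) (trans (cong (λ w → lookup w k) eq) (lookup-codeword H i′ s′ k))
      row-product : ∑[ k < suc n ] (H i k * H i′ k) ≡ + suc n * signed (s xor s′)
      row-product = trans (sum-cong-≗ λ k → trans (entry*entry i k i′ k) (cong signed (xor-transpose s _ s′ _ (bits-agree k))))
                          (∑-const (suc n) (signed (s xor s′)))
      orthogonality-forces : ∀ (d : Dec (i ≡ i′)) t → + suc n * signed t ≡ (if ⌊ d ⌋ then + suc n else 0ℤ) →
                             i ≡ i′ × t ≡ false
      orthogonality-forces (yes i≡i′) false _ = i≡i′ , refl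
      orthogonality-forces (yes _)    true  ()
      orthogonality-forces (no _)     false ()
      orthogonality-forces (no _)     true  ()

    hadamardCode-unique : Unique (hadamardCode H)
    hadamardCode-unique =
      UniqueP.cartesianProductWith⁺ (codeword H) codeword-injective (UniqueP.allFin⁺ (suc n)) bits-unique
      where
      bits-unique : Unique bits
      bits-unique = ((λ ()) ∷ []) ∷ [] ∷ []

    length-hadamardCode : length (hadamardCode H) ≡ suc n ℕ.* 2
    length-hadamardCode = trans (length-cartesianProductWith (codeword H) (allFin (suc n)) bits)
                                (cong (ℕ._* 2) (ListP.length-tabulate {n = suc n} (λ i → i)))

    count-coordinate : ∀ c b → length (filter (coordinate? c b) (hadamardCode H)) ≡ suc n
    count-coordinate c b = ℤP.+-injective (begin
      + length (filter (coordinate? c b) (hadamardCode H))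
        ≡⟨ length-filter-cartesianProductWith (coordinate? c b) (codeword H) (λ i → i) bits ⟩
      ∑[ i < suc n ] (+ length (filter (coordinate? c b ∘ codeword H i) bits))
        ≡⟨ sum-cong-≗ (λ i → cong +_ (length-filter-codeword-coordinate H i c b)) ⟩
      ∑[ i < suc n ] (+ 1)
        ≡⟨ ∑-const (suc n) (+ 1) ⟩
      + suc n * + 1
        ≡⟨ ℤP.*-identityʳ (+ suc n) ⟩
      + suc n ∎)
      where open ≡-Reasoning

    count-coordinates : ∀ {c j} → c ≢ j → ∀ b b′ →
                        2 ℕ.* length (filter (coordinates? c b j b′) (hadamardCode H)) ≡ suc n
    count-coordinates {c} {j} c≢j b b′ = ℤP.+-injective (begin
      + (2 ℕ.* length (filter P? (hadamardCode H)))
        ≡⟨ ℤP.pos-* 2 (length (filter P? (hadamardCode H))) ⟩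
      + 2 * + length (filter P? (hadamardCode H))
        ≡⟨ cong (_*_ (+ 2)) (length-filter-cartesianProductWith P? (codeword H) (λ i → i) bits) ⟩
      + 2 * ∑[ i < suc n ] (+ length (filter (P? ∘ codeword H i) bits))
        ≡⟨ *-distribˡ-sum (+ 2) (λ i → + length (filter (P? ∘ codeword H i) bits)) ⟩
      ∑[ i < suc n ] (+ 2 * + length (filter (P? ∘ codeword H i) bits))
        ≡⟨ sum-cong-≗ row-pair ⟩
      ∑[ i < suc n ] (+ 1 + (H i c * H i j) * σ)
        ≡⟨ ∑-distrib-+ (λ _ → + 1) (λ i → (H i c * H i j) * σ) ⟩
      ∑[ i < suc n ] (+ 1) + ∑[ i < suc n ] ((H i c * H i j) * σ)
        ≡⟨ cong₂ _+_ (trans (∑-const (suc n) (+ 1)) (ℤP.*-identityʳ (+ suc n)))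
                     (sym (*-distribʳ-sum σ (λ i → H i c * H i j))) ⟩
      + suc n + ∑[ i < suc n ] (H i c * H i j) * σ
        ≡⟨ cong (λ v → + suc n + v * σ) (columns-orthogonal c≢j) ⟩
      + suc n + 0ℤ * σ
        ≡⟨ cong (_+_ (+ suc n)) (ℤP.*-zeroˡ σ) ⟩
      + suc n + 0ℤ
        ≡⟨ ℤP.+-identityʳ (+ suc n) ⟩
      + suc n ∎)
      where
      open ≡-Reasoning
      σ = signed (b xor b′)
      P? = coordinates? c b j b′
      row-pair : ∀ i → + 2 * + length (filter (P? ∘ codeword H i) bits) ≡ + 1 + (H i c * H i j) * σ
      row-pair i = begin
        + 2 * + length (filter (P? ∘ codeword H i) bits)    ≡⟨ ℤP.pos-* 2 (length (filter (P? ∘ codeword H i) bits)) ⟨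
        + (2 ℕ.* length (filter (P? ∘ codeword H i) bits))  ≡⟨ length-filter-codeword-coordinates H i c b j b′ ⟩
        + 1 + signed (toBit (H i c) xor toBit (H i j)) * σ   ≡⟨ cong (λ v → + 1 + v * σ) (entry*entry i c i j) ⟨
        + 1 + (H i c * H i j) * σ                            ∎

open Hadamard

-- Propelinear codes

module Propelinear {m} {C : List (Word m)} {π : Word m → Permutation′ m} (isPropelinear : IsPropelinear C π) where

  infixl 7 _∙_
  _∙_ : Word m → Word m → Word m
  _∙_ = prodP π

  𝟎∈C : 𝟎 ∈ C
  𝟎∈C = proj₁ isPropelinear

  ∙-closed : ∀ {x y} → x ∈ C → y ∈ C → x ∙ y ∈ C
  ∙-closed {x} {y} x∈C y∈C = proj₁ (proj₂ isPropelinear x y x∈C y∈C)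

  π-homomorphic : ∀ {x y} → x ∈ C → y ∈ C → ∀ i → π x ⟨$⟩ʳ (π y ⟨$⟩ʳ i) ≡ π (x ∙ y) ⟨$⟩ʳ i
  π-homomorphic {x} {y} x∈C y∈C = proj₂ (proj₂ isPropelinear x y x∈C y∈C)

  ∙-assoc : ∀ {x y z} → x ∈ C → y ∈ C → z ∈ C → (x ∙ y) ∙ z ≡ x ∙ (y ∙ z)
  ∙-assoc {x} {y} {z} x∈C y∈C z∈C = begin
    (x ⊕ act (π x) y) ⊕ act (π (x ∙ y)) z         ≡⟨ ⊕-assoc x (act (π x) y) _ ⟩
    x ⊕ (act (π x) y ⊕ act (π (x ∙ y)) z)         ≡⟨ cong (λ w → x ⊕ (act (π x) y ⊕ w))
                                                           (act-∘ (π x) (π y) (π (x ∙ y)) (π-homomorphic x∈C y∈C) z) ⟨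
    x ⊕ (act (π x) y ⊕ act (π x) (act (π y) z))   ≡⟨ cong (x ⊕_) (act-⊕ (π x) y (act (π y) z)) ⟨
    x ⊕ act (π x) (y ⊕ act (π y) z)               ∎
    where open ≡-Reasoning

  ∙-identityʳ : ∀ x → x ∙ 𝟎 ≡ x
  ∙-identityʳ x = trans (cong (x ⊕_) (act-𝟎 (π x))) (⊕-identityʳ x)

  π𝟎≗id : ∀ i → π 𝟎 ⟨$⟩ʳ i ≡ i
  π𝟎≗id i = begin
    π 𝟎 ⟨$⟩ʳ i                              ≡⟨ inverseˡ (π 𝟎) ⟨
    π 𝟎 ⟨$⟩ˡ (π 𝟎 ⟨$⟩ʳ (π 𝟎 ⟨$⟩ʳ i))         ≡⟨ cong (π 𝟎 ⟨$⟩ˡ_) (π-homomorphic 𝟎∈C 𝟎∈C i) ⟩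
    π 𝟎 ⟨$⟩ˡ (π (𝟎 ∙ 𝟎) ⟨$⟩ʳ i)              ≡⟨ cong (λ w → π 𝟎 ⟨$⟩ˡ (π w ⟨$⟩ʳ i)) (∙-identityʳ 𝟎) ⟩
    π 𝟎 ⟨$⟩ˡ (π 𝟎 ⟨$⟩ʳ i)                    ≡⟨ inverseˡ (π 𝟎) ⟩
    i                                       ∎
    where open ≡-Reasoning

  ∙-identityˡ : ∀ x → 𝟎 ∙ x ≡ x
  ∙-identityˡ x = trans (⊕-identityˡ _) (act-id (π 𝟎) π𝟎≗id x)

  ∙-𝟏 : ∀ x → x ∙ 𝟏 ≡ x ⊕ 𝟏
  ∙-𝟏 x = cong (x ⊕_) (act-𝟏 (π x))

  ∙-cancelˡ : ∀ x {y z} → x ∙ y ≡ x ∙ z → y ≡ z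
  ∙-cancelˡ x = act-injective (π x) ∘ ⊕-cancelˡ x

  ∙-inverseʳ : Unique C → ∀ {x} → x ∈ C → ∃ λ y → y ∈ C × x ∙ y ≡ 𝟎
  ∙-inverseʳ unique {x} x∈C = let y , y∈C , 𝟎≡xy = ∈P.∈-map⁻ (x ∙_) (C⊆xC 𝟎∈C) in y , y∈C , sym 𝟎≡xy
    where
    xC⊆C : ∀ {z} → z ∈ map (x ∙_) C → z ∈ C
    xC⊆C z∈xC with y , y∈C , refl ← ∈P.∈-map⁻ (x ∙_) z∈xC = ∙-closed x∈C y∈C
    C⊆xC : ∀ {z} → z ∈ C → z ∈ map (x ∙_) C
    C⊆xC = Unique-⊆-length≥⇒⊇ _≟w_ (UniqueP.map⁺ (∙-cancelˡ x) unique) xC⊆C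
                                     (ℕP.≤-reflexive (sym (ListP.length-map (x ∙_) C)))

  left-inverse≡right-inverse : ∀ {x y z} → x ∈ C → y ∈ C → z ∈ C → x ∙ y ≡ 𝟎 → y ∙ z ≡ 𝟎 → x ≡ z
  left-inverse≡right-inverse {x} {y} {z} x∈C y∈C z∈C xy≡𝟎 yz≡𝟎 = begin
    x             ≡⟨ ∙-identityʳ x ⟨
    x ∙ 𝟎         ≡⟨ cong (x ∙_) yz≡𝟎 ⟨
    x ∙ (y ∙ z)   ≡⟨ ∙-assoc x∈C y∈C z∈C ⟨
    (x ∙ y) ∙ z   ≡⟨ cong (_∙ z) xy≡𝟎 ⟩
    𝟎 ∙ z         ≡⟨ ∙-identityˡ z ⟩
    z             ∎
    where open ≡-Reasoning

  ∙-inverse : Unique C → ∀ {x} → x ∈ C → ∃ λ y → y ∈ C × x ∙ y ≡ 𝟎 × y ∙ x ≡ 𝟎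
  ∙-inverse unique {x} x∈C =
    let y , y∈C , xy≡𝟎 = ∙-inverseʳ unique x∈C
        z , z∈C , yz≡𝟎 = ∙-inverseʳ unique y∈C
    in y , y∈C , xy≡𝟎 , trans (cong (y ∙_) (left-inverse≡right-inverse x∈C y∈C z∈C xy≡𝟎 yz≡𝟎)) yz≡𝟎

  isFiniteGroup : Unique C → IsFiniteGroup _≟w_ C _∙_ 𝟎
  isFiniteGroup unique =
    unique , 𝟎∈C , (λ _ _ → ∙-closed) , (λ _ _ _ → ∙-assoc) ,
    (λ x _ → ∙-identityˡ x , ∙-identityʳ x) , (λ _ → ∙-inverse unique)

-- Finite groups

module FiniteGroup {A : Set} {_≟_ : DecidableEquality A} {G : List A} {_∙_ : A → A → A} {e : A}
                   (isGroup : IsFiniteGroup _≟_ G _∙_ e) where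

  private
    unique : Unique G
    unique = proj₁ isGroup
    ∙-closed : ∀ {x y} → x ∈ G → y ∈ G → x ∙ y ∈ G
    ∙-closed = proj₁ (proj₂ (proj₂ isGroup)) _ _
    ∙-assoc : ∀ {x y z} → x ∈ G → y ∈ G → z ∈ G → (x ∙ y) ∙ z ≡ x ∙ (y ∙ z)
    ∙-assoc = proj₁ (proj₂ (proj₂ (proj₂ isGroup))) _ _ _
    ∙-identityˡ : ∀ {x} → x ∈ G → e ∙ x ≡ x
    ∙-identityˡ x∈G = proj₁ (proj₁ (proj₂ (proj₂ (proj₂ (proj₂ isGroup)))) _ x∈G)

  inverse : ∀ {a} → a ∈ G → ∃ λ a′ → a′ ∈ G × a ∙ a′ ≡ e × a′ ∙ a ≡ e
  inverse = proj₂ (proj₂ (proj₂ (proj₂ (proj₂ isGroup)))) _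

  ∈-translate⇔ : ∀ {a a′ D y} → a ∈ G → a′ ∈ G → a ∙ a′ ≡ e → a′ ∙ a ≡ e → D ⊆ G → y ∈ G →
                 y ∈ map (a ∙_) D ⇔ a′ ∙ y ∈ D
  ∈-translate⇔ {a} {a′} {D} {y} a∈G a′∈G aa′≡e a′a≡e D⊆G y∈G = mk⇔ to from
    where
    cancel : ∀ {x y z} → x ∈ G → y ∈ G → z ∈ G → x ∙ y ≡ e → x ∙ (y ∙ z) ≡ z
    cancel x∈G y∈G z∈G xy≡e = trans (sym (∙-assoc x∈G y∈G z∈G)) (trans (cong (_∙ _) xy≡e) (∙-identityˡ z∈G))
    to : y ∈ map (a ∙_) D → a′ ∙ y ∈ D
    to y∈aD with d , d∈D , refl ← ∈P.∈-map⁻ (a ∙_) y∈aD = subst (_∈ D) (sym (cancel a′∈G a∈G (D⊆G d∈D) a′a≡e)) d∈D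
    from : a′ ∙ y ∈ D → y ∈ map (a ∙_) D
    from a′y∈D = subst (_∈ map (a ∙_) D) (cancel a∈G a′∈G y∈G aa′≡e) (∈P.∈-map⁺ (a ∙_) a′y∈D)

  ∈-translate-filter⇔ : ∀ {P : A → Set} (P? : Decidable P) {a y} (a∈G : a ∈ G) → y ∈ G →
                        y ∈ map (a ∙_) (filter P? G) ⇔ P (proj₁ (inverse a∈G) ∙ y)
  ∈-translate-filter⇔ P? a∈G y∈G =
    let a′ , a′∈G , aa′≡e , a′a≡e = inverse a∈G
        translate = ∈-translate⇔ a∈G a′∈G aa′≡e a′a≡e (proj₁ ∘ ∈P.∈-filter⁻ P? {xs = G}) y∈G
    in mk⇔ (proj₂ ∘ ∈P.∈-filter⁻ P? {xs = G} ∘ Equivalence.to translate)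
           (Equivalence.from translate ∘ ∈P.∈-filter⁺ P? (∙-closed a′∈G y∈G))

  ∣aD∩bbu∣≡1 : ∀ {P : A → Set} (P? : Decidable P) {u} → u ∈ G → (∀ {g} → g ∈ G → P (g ∙ u) ⇔ (¬ P g)) →
               ∀ {a b} → a ∈ G → b ∈ G → ∣aD∩bbu∣ _≟_ G _∙_ (filter P? G) u a b ≡ 1
  ∣aD∩bbu∣≡1 {P} P? {u} u∈G flips {a} {b} a∈G b∈G = count (P? (a′ ∙ b))
    where
    a′ = proj₁ (inverse a∈G)
    a′∈G = proj₁ (proj₂ (inverse a∈G))
    D = filter P? G
    bu∈G = ∙-closed b∈G u∈G
    P[a′[bu]]⇔¬P[a′b] : P (a′ ∙ (b ∙ u)) ⇔ (¬ P (a′ ∙ b))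
    P[a′[bu]]⇔¬P[a′b] = subst (λ g → P g ⇔ (¬ P (a′ ∙ b))) (∙-assoc a′∈G b∈G u∈G) (flips (∙-closed a′∈G b∈G))
    count : Dec (P (a′ ∙ b)) → ∣aD∩bbu∣ _≟_ G _∙_ D u a b ≡ 1
    count (yes P[a′b]) = length-filter≡1 _ unique b∈G λ _ → mk⇔ to from
      where
      to : ∀ {y} → y ∈ map (a ∙_) D × (y ≡ b ⊎ y ≡ b ∙ u) → y ≡ b
      to (_     , inj₁ y≡b)  = y≡b
      to (y∈aD , inj₂ refl) = contradiction P[a′b]
        (Equivalence.to P[a′[bu]]⇔¬P[a′b] (Equivalence.to (∈-translate-filter⇔ P? a∈G bu∈G) y∈aD))
      from : ∀ {y} → y ≡ b → y ∈ map (a ∙_) D × (y ≡ b ⊎ y ≡ b ∙ u)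
      from refl = Equivalence.from (∈-translate-filter⇔ P? a∈G b∈G) P[a′b] , inj₁ refl
    count (no ¬P[a′b]) = length-filter≡1 _ unique bu∈G λ _ → mk⇔ to from
      where
      to : ∀ {y} → y ∈ map (a ∙_) D × (y ≡ b ⊎ y ≡ b ∙ u) → y ≡ b ∙ u
      to (y∈aD , inj₁ refl) = contradiction (Equivalence.to (∈-translate-filter⇔ P? a∈G b∈G) y∈aD) ¬P[a′b]
      to (_     , inj₂ y≡bu) = y≡bu
      from : ∀ {y} → y ≡ b ∙ u → y ∈ map (a ∙_) D × (y ≡ b ⊎ y ≡ b ∙ u)
      from refl = Equivalence.from (∈-translate-filter⇔ P? a∈G bu∈G)
                    (Equivalence.from P[a′[bu]]⇔¬P[a′b] ¬P[a′b]) , inj₂ refl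

-- HFP-codes

-- Multiplication on ℕ, as in the statement; inside Hadamard, _*_ is the one on ℤ.
open import Data.Nat using (_*_)

module BinaryHadamardCode {n} {C : List (Word (suc n))} (isCode : IsBinaryHadamardCode (suc n) C) where

  H : Fin (suc n) → Fin (suc n) → ℤ
  H = proj₁ (proj₂ isCode)

  open HadamardCode (proj₁ (proj₂ (proj₂ isCode))) public

  private
    members : ∀ x → (x ∈ C → ∃ λ i → x ≡ binRow H i ⊎ x ≡ 𝟏 ⊕ binRow H i) ×
                    ((∃ λ i → x ≡ binRow H i ⊎ x ≡ 𝟏 ⊕ binRow H i) → x ∈ C)
    members = proj₂ (proj₂ (proj₂ isCode))

  C↭hadamardCode : C ↭ hadamardCode H
  C↭hadamardCode = Unique-same-elements⇒↭ (proj₁ isCode) hadamardCode-unique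
    (mk⇔ (Equivalence.from (∈-hadamardCode⇔ H) ∘ proj₁ (members _))
         (proj₂ (members _) ∘ Equivalence.to (∈-hadamardCode⇔ H)))

  length-filter-C : ∀ {P : Word (suc n) → Set} (P? : Decidable P) →
                    length (filter P? C) ≡ length (filter P? (hadamardCode H))
  length-filter-C P? = ↭-length (filter-↭ P? C↭hadamardCode)

  ∈-complement : ∀ {x} → x ∈ C → 𝟏 ⊕ x ∈ C
  ∈-complement {x} x∈C with proj₁ (members x) x∈C
  ... | i , inj₁ refl = proj₂ (members _) (i , inj₂ refl)
  ... | i , inj₂ refl = proj₂ (members _) (i , inj₁ (⊕-self-cancelˡ 𝟏 (binRow H i)))

module HFPCode {k} {C : List (Word (4 * suc k))} {π : Word (4 * suc k) → Permutation′ (4 * suc k)}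
               (isHFP : IsHFPCode (suc k) C π) where

  open Propelinear {C = C} {π = π} (proj₁ isHFP)
  open BinaryHadamardCode {C = C} (proj₁ (proj₂ isHFP))

  private
    C-unique : Unique C
    C-unique = proj₁ (proj₁ (proj₂ isHFP))
    π𝟏≗id : ∀ i → π 𝟏 ⟨$⟩ʳ i ≡ i
    π𝟏≗id = proj₁ (proj₂ (proj₂ (proj₂ isHFP)))
    fixed-point-free : ∀ a → a ∈ C → a ≢ 𝟎 → a ≢ 𝟏 → ∀ i → π a ⟨$⟩ʳ i ≢ i
    fixed-point-free = proj₂ (proj₂ (proj₂ (proj₂ isHFP)))

  C-isFiniteGroup : IsFiniteGroup _≟w_ C _∙_ 𝟎
  C-isFiniteGroup = isFiniteGroup C-unique

  open FiniteGroup {_≟_ = _≟w_} {G = C} {_∙_ = _∙_} {e = 𝟎} C-isFiniteGroup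

  𝟏∈C : 𝟏 ∈ C
  𝟏∈C = subst (_∈ C) (⊕-identityʳ 𝟏) (∈-complement 𝟎∈C)

  𝟏≢𝟎 : 𝟏 {4 * suc k} ≢ 𝟎
  𝟏≢𝟎 ()

  𝟏∙ : ∀ x → 𝟏 ∙ x ≡ 𝟏 ⊕ x
  𝟏∙ x = cong (𝟏 ⊕_) (act-id (π 𝟏) π𝟏≗id x)

  𝟏-central : ∀ x → x ∙ 𝟏 ≡ 𝟏 ∙ x
  𝟏-central x = trans (∙-𝟏 x) (trans (⊕-comm x 𝟏) (sym (𝟏∙ x)))

  head-∙𝟏 : ∀ x → head (x ∙ 𝟏) ≡ not (head x)
  head-∙𝟏 x = begin
    head (x ∙ 𝟏)          ≡⟨ head≡lookup-zero (x ∙ 𝟏) ⟩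
    lookup (x ∙ 𝟏) zero   ≡⟨ cong (λ w → lookup w zero) (trans (∙-𝟏 x) (⊕-comm x 𝟏)) ⟩
    lookup (𝟏 ⊕ x) zero   ≡⟨ lookup-𝟏⊕ x zero ⟩
    not (lookup x zero)   ≡⟨ cong not (head≡lookup-zero x) ⟨
    not (head x)          ∎
    where open ≡-Reasoning

  D₁⊆C : ∀ {x} → x ∈ D₁ C → x ∈ C
  D₁⊆C = proj₁ ∘ ∈P.∈-filter⁻ firstIs0? {xs = C}

  ∈D₁⇔ : ∀ {x} → x ∈ C → x ∈ D₁ C ⇔ lookup x zero ≡ false
  ∈D₁⇔ {x} x∈C = mk⇔ (Equivalence.to (head≡⇔lookup-zero≡ x) ∘ proj₂ ∘ ∈P.∈-filter⁻ firstIs0? {xs = C})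
                     (∈P.∈-filter⁺ firstIs0? x∈C ∘ Equivalence.from (head≡⇔lookup-zero≡ x))

  length-C : length C ≡ 8 * suc k
  length-C = begin
    length C                   ≡⟨ ↭-length C↭hadamardCode ⟩
    length (hadamardCode H)    ≡⟨ length-hadamardCode ⟩
    (4 * suc k) * 2            ≡⟨ ℕP.*-comm (4 * suc k) 2 ⟩
    2 * (4 * suc k)            ≡⟨ ℕP.*-assoc 2 4 (suc k) ⟨
    8 * suc k                  ∎
    where open ≡-Reasoning

  length-D₁ : length (D₁ C) ≡ 4 * suc k
  length-D₁ = begin
    length (filter firstIs0? C)
      ≡⟨ length-filter-cong firstIs0? (coordinate? zero false) C (λ {y} _ → head≡⇔lookup-zero≡ y) ⟩
    length (filter (coordinate? zero false) C)
      ≡⟨ length-filter-C (coordinate? zero false) ⟩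
    length (filter (coordinate? zero false) (hadamardCode H))
      ≡⟨ count-coordinate zero false ⟩
    4 * suc k                                                  ∎
    where open ≡-Reasoning

  𝟏∙𝟏≡𝟎 : 𝟏 ∙ 𝟏 ≡ 𝟎
  𝟏∙𝟏≡𝟎 = trans (∙-𝟏 𝟏) (⊕-self 𝟏)

  D₁-unique : Unique (D₁ C)
  D₁-unique = UniqueP.filter⁺ firstIs0? C-unique

  ∣aD₁∩bb𝟏∣≡1 : ∀ {a b} → a ∈ C → b ∈ C → ∣aD∩bbu∣ _≟w_ C _∙_ (D₁ C) 𝟏 a b ≡ 1
  ∣aD₁∩bb𝟏∣≡1 = ∣aD∩bbu∣≡1 firstIs0? 𝟏∈C flips
    where
    flips : ∀ {g} → g ∈ C → head (g ∙ 𝟏) ≡ false ⇔ (¬ head g ≡ false)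
    flips {g} _ = subst (λ h → h ≡ false ⇔ (¬ head g ≡ false)) (sym (head-∙𝟏 g)) not≡false⇔≢false

  module Translate {a} (a∈C : a ∈ C) where

    a⁻¹ : Word (4 * suc k)
    a⁻¹ = proj₁ (inverse a∈C)

    a⁻¹∈C : a⁻¹ ∈ C
    a⁻¹∈C = proj₁ (proj₂ (inverse a∈C))

    a∙a⁻¹≡𝟎 : a ∙ a⁻¹ ≡ 𝟎
    a∙a⁻¹≡𝟎 = proj₁ (proj₂ (proj₂ (inverse a∈C)))

    a⁻¹≢𝟎 : a ≢ 𝟎 → a⁻¹ ≢ 𝟎
    a⁻¹≢𝟎 a≢𝟎 a⁻¹≡𝟎 = a≢𝟎 (trans (sym (∙-identityʳ a)) (trans (cong (a ∙_) (sym a⁻¹≡𝟎)) a∙a⁻¹≡𝟎))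

    a⁻¹≢𝟏 : a ≢ 𝟏 → a⁻¹ ≢ 𝟏
    a⁻¹≢𝟏 a≢𝟏 a⁻¹≡𝟏 = a≢𝟏 (⊕-cancelˡ 𝟏 (begin
      𝟏 ⊕ a      ≡⟨ ⊕-comm 𝟏 a ⟩
      a ⊕ 𝟏      ≡⟨ ∙-𝟏 a ⟨
      a ∙ 𝟏      ≡⟨ cong (a ∙_) a⁻¹≡𝟏 ⟨
      a ∙ a⁻¹    ≡⟨ a∙a⁻¹≡𝟎 ⟩
      𝟎          ≡⟨ ⊕-self 𝟏 ⟨
      𝟏 ⊕ 𝟏      ∎))
      where open ≡-Reasoning

    j : Fin (4 * suc k)
    j = π a⁻¹ ⟨$⟩ˡ zero

    lookup-a⁻¹∙ : ∀ y → lookup (a⁻¹ ∙ y) zero ≡ lookup a⁻¹ zero xor lookup y j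
    lookup-a⁻¹∙ y =
      trans (lookup-⊕ a⁻¹ (act (π a⁻¹) y) zero) (cong (lookup a⁻¹ zero xor_) (lookup-act (π a⁻¹) y zero))

    ∈aD₁⇔ : ∀ {y} → y ∈ C → y ∈ map (a ∙_) (D₁ C) ⇔ lookup y j ≡ lookup a⁻¹ zero
    ∈aD₁⇔ {y} y∈C = mk⇔
      (λ y∈aD → sym (Equivalence.to xor≡false⇔≡ (begin
        lookup a⁻¹ zero xor lookup y j ≡⟨ lookup-a⁻¹∙ y ⟨
        lookup (a⁻¹ ∙ y) zero          ≡⟨ head≡lookup-zero (a⁻¹ ∙ y) ⟨
        head (a⁻¹ ∙ y)                 ≡⟨ Equivalence.to (∈-translate-filter⇔ firstIs0? a∈C y∈C) y∈aD ⟩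
        false                          ∎)))
      (λ yⱼ≡a⁻¹₀ → Equivalence.from (∈-translate-filter⇔ firstIs0? a∈C y∈C) (begin
        head (a⁻¹ ∙ y)                 ≡⟨ head≡lookup-zero (a⁻¹ ∙ y) ⟩
        lookup (a⁻¹ ∙ y) zero          ≡⟨ lookup-a⁻¹∙ y ⟩
        lookup a⁻¹ zero xor lookup y j ≡⟨ Equivalence.from xor≡false⇔≡ (sym yⱼ≡a⁻¹₀) ⟩
        false                          ∎))
      where open ≡-Reasoning

  ∣aD₁∩D₁∣≡2n : ∀ {a} → a ∈ C → a ≢ 𝟎 → a ≢ 𝟏 → ∣aD∩D∣ _≟w_ C _∙_ (D₁ C) a ≡ 2 * suc k
  ∣aD₁∩D₁∣≡2n {a} a∈C a≢𝟎 a≢𝟏 = ℕP.*-cancelˡ-≡ _ (2 * suc k) 2 (begin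
    2 * ∣aD∩D∣ _≟w_ C _∙_ (D₁ C) a
      ≡⟨ cong (2 *_) (length-filter-cong _ P? C (λ y∈C → ∈aD₁⇔ y∈C ×-⇔ ∈D₁⇔ y∈C)) ⟩
    2 * length (filter P? C)                 ≡⟨ cong (2 *_) (length-filter-C P?) ⟩
    2 * length (filter P? (hadamardCode H))  ≡⟨ count-coordinates j≢0 (lookup a⁻¹ zero) false ⟩
    4 * suc k                                ≡⟨ ℕP.*-assoc 2 2 (suc k) ⟩
    2 * (2 * suc k)                          ∎)
    where
    open ≡-Reasoning
    open Translate a∈C
    P? = coordinates? j (lookup a⁻¹ zero) zero false
    j≢0 : j ≢ zero
    j≢0 j≡0 = fixed-point-free a⁻¹ a⁻¹∈C (a⁻¹≢𝟎 a≢𝟎) (a⁻¹≢𝟏 a≢𝟏) zero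
                (trans (cong (π a⁻¹ ⟨$⟩ʳ_) (sym j≡0)) (inverseʳ (π a⁻¹)))

proposition1 : (k : ℕ) → (C : List (Word (4 * suc k))) →
               (π : Word (4 * suc k) → Permutation′ (4 * suc k)) →
               IsHFPCode (suc k) C π →
               IsLeftHadamardGroup _≟w_ (suc k) C (prodP π) 𝟎 (D₁ C) 𝟏
proposition1 k C π isHFP =
  C-isFiniteGroup , length-C ,
  D₁-unique , All.tabulate D₁⊆C , length-D₁ ,
  𝟏∈C , 𝟏≢𝟎 , 𝟏∙𝟏≡𝟎 , (λ g _ → 𝟏-central g) ,
  (λ _ a∈C a≢𝟎 a≢𝟏 → ∣aD₁∩D₁∣≡2n a∈C a≢𝟎 a≢𝟏) ,
  (λ _ _ a∈C b∈C → ∣aD₁∩bb𝟏∣≡1 a∈C b∈C)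
  where open HFPCode {C = C} {π = π} isHFP
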